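{- Let $n\ge 1$. The graph $nK_2$ is $n$-super graceful if and only if $n=1$; likewise $nK_2$ is $n$-sequentially additive if and only if $n=1$.
   Context: $nK_2$ denotes the disjoint union of $n$ copies of $K_2$. For integers $a\le b$, $[a,b]$ is the set of integers between $a$ and $b$ inclusive. For a graph $G=(V,E)$ with $p$ vertices and $q$ edges and $k\ge1$: a $k$-super graceful labeling is a bijection $f:V\cup E\to[k,k+p+q-1]$ with $f(uv)=|f(u)-f(v)|$ for every edge $uv$; a $k$-sequentially additive labeling is a bijection $f:V\cup E\to[k,k+p+q-1]$ with $f(uv)=f(u)+f(v)$ for every edge $uv$. $G$ is $k$-super graceful (resp. $k$-sequentially additive) if it admits such a labeling. -}

module Defs where

open import Data.Nat using (ℕ; _+_; _∸_; _≤_)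
open import Data.Fin using (Fin; _↑ˡ_; _↑ʳ_)
open import Data.Sum using (_⊎_; inj₁; inj₂)
open import Data.Product using (_×_; _,_; Σ; ∃)
open import Relation.Binary.PropositionalEquality using (_≡_)
open import Function.Definitions using (Injective)

open import Data.Nat using (∣_-_∣) public

record Graph : Set where
  field
    p    : ℕ
    q    : ℕ
    ends : Fin q → Fin p × Fin p

open Graph public

Elem : Graph → Set
Elem G = Fin (p G) ⊎ Fin (q G)

InRange : ℕ → ℕ → ℕ → Set
InRange k size m = (k ≤ m) × (m ≤ k + size ∸ 1)

IsBijOnto : (G : Graph) → ℕ → (Elem G → ℕ) → Set
IsBijOnto G k f =
  ((x : Elem G) → InRange k (p G + q G) (f x)) ×
  Injective _≡_ _≡_ f ×
  ((m : ℕ) → InRange k (p G + q G) m → ∃ λ x → f x ≡ m)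

endL endR : (G : Graph) → Fin (q G) → Fin (p G)
endL G e with ends G e
... | (u , v) = u
endR G e with ends G e
... | (u , v) = v

IsKSuperGraceful : (G : Graph) → ℕ → (Elem G → ℕ) → Set
IsKSuperGraceful G k f =
  IsBijOnto G k f ×
  ((e : Fin (q G)) → f (inj₂ e) ≡ ∣ f (inj₁ (endL G e)) - f (inj₁ (endR G e)) ∣)

IsKSeqAdditive : (G : Graph) → ℕ → (Elem G → ℕ) → Set
IsKSeqAdditive G k f =
  IsBijOnto G k f ×
  ((e : Fin (q G)) → f (inj₂ e) ≡ f (inj₁ (endL G e)) + f (inj₁ (endR G e)))

KSuperGraceful : Graph → ℕ → Set
KSuperGraceful G k = Σ (Elem G → ℕ) (IsKSuperGraceful G k)

KSeqAdditive : Graph → ℕ → Set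
KSeqAdditive G k = Σ (Elem G → ℕ) (IsKSeqAdditive G k)

nK₂ : ℕ → Graph
nK₂ n = record { p = n + n ; q = n ; ends = λ i → (i ↑ˡ n , n ↑ʳ i) }

module Submission where

-- Every component of nK₂ is a single edge, so a labelling of it is a
-- triple (left end, right end, edge).  A triple with e = ∣ a - b ∣ becomes one
-- with "edge = left + right" after exchanging the edge label with the label
-- of the larger end, and conversely a triple with e = a + b becomes graceful
-- after exchanging e with a.  Doing this in every component is an involution
-- of V ∪ E, so it preserves bijectivity: for nK₂ the two notions coincide,
-- for every n and k.  It therefore suffices to treat sequential additivity.
-- There the n edge labels sum to the sum of the 2n vertex labels; but 2n
-- distinct labels ≥ n are too large for n distinct labels < 4n to match
-- once n ≥ 2 (a sum estimate for distinct naturals).  For n = 1, ends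
-- labelled 1 and 2 with edge 3 work.

open import Defs
open import Data.Nat
open import Data.Nat.Properties
open import Data.Nat.ListAction using (sum)
open import Data.Nat.ListAction.Properties using (sum-↭)
open import Data.Nat.Tactic.RingSolver using (solve-∀)
open import Algebra.Properties.CommutativeSemigroup +-commutativeSemigroup using (interchange)
open import Data.Fin using (Fin; _↑ˡ_; _↑ʳ_; splitAt; join)
open import Data.Fin.Properties using (splitAt-↑ˡ; splitAt-↑ʳ; join-splitAt)
open import Data.Sum using (_⊎_; inj₁; inj₂; [_,_]′)
open import Data.Sum.Properties using (inj₁-injective; inj₂-injective)
open import Data.Product using (_×_; _,_; proj₁; proj₂; Σ; uncurry)
open import Data.List using ([]; _∷_; length; tabulate)
open import Data.List.Properties using (length-tabulate; tabulate-cong)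
open import Data.List.Relation.Unary.All using (All; []; _∷_)
import Data.List.Relation.Unary.All.Properties as All
open import Data.List.Relation.Unary.AllPairs using (_∷_)
open import Data.List.Relation.Unary.Linked using (Linked; []; [-]; _∷_)
import Data.List.Relation.Unary.Linked as Linked
open import Data.List.Relation.Unary.Linked.Properties using (Linked⇒All)
open import Data.List.Relation.Unary.Unique.Propositional using (Unique)
import Data.List.Relation.Unary.Unique.Propositional.Properties as Unique
open import Data.List.Relation.Binary.Permutation.Propositional using (↭⇒↭ₛ; ↭-sym)
open import Data.List.Relation.Binary.Permutation.Propositional.Properties using (All-resp-↭; ↭-length)
open import Data.List.Relation.Binary.Permutation.Setoid.Properties using (Unique-resp-↭)
import Data.List.Sort
open import Data.Empty using (⊥-elim)
open import Function using (_∘_)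
open import Function.Bundles using (_⇔_; mk⇔)
open import Function.Construct.Composition using (_⇔-∘_)
open import Relation.Nullary using (¬_)
open import Relation.Binary.PropositionalEquality

module Sort = Data.List.Sort ≤-decTotalOrder

-- With m elements, distinct naturals
-- ≥ c sum to at least m·c + m(m-1)/2, and distinct naturals < D to at most
-- m·D - m(m+1)/2; both are stated multiplied by 2 to stay in ℕ.

strictlyIncreasing : ∀ {xs} → Linked _≤_ xs → Unique xs → Linked _<_ xs
strictlyIncreasing []                    _                  = []
strictlyIncreasing [-]                   _                  = [-]
strictlyIncreasing (x≤y ∷ sorted) ((x≢y ∷ _) ∷ distinct) =
  ≤∧≢⇒< x≤y x≢y ∷ strictlyIncreasing sorted distinct

aboveHead : ∀ {x xs} → Linked _<_ (x ∷ xs) → All (x <_) xs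
aboveHead [-]           = []
aboveHead (x<y ∷ incr) = Linked⇒All <-trans x<y incr

fromIncreasing : (Q : ℕ → Set) (Bound : ℕ → ℕ → Set) →
  (∀ {ys} → Linked _<_ ys → All Q ys → Bound (length ys) (sum ys)) →
  ∀ {xs} → Unique xs → All Q xs → Bound (length xs) (sum xs)
fromIncreasing Q Bound bound {xs} distinct qs =
  subst₂ Bound (↭-length sorted↭xs) (sum-↭ sorted↭xs)
    (bound (strictlyIncreasing (Sort.sort-↗ xs) sortedDistinct)
           (All-resp-↭ (↭-sym sorted↭xs) qs))
  where
    sorted↭xs = Sort.sort-↭ xs
    sortedDistinct : Unique (Sort.sort xs)
    sortedDistinct = Unique-resp-↭ (setoid ℕ) (↭⇒↭ₛ (↭-sym sorted↭xs)) distinct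

sumLowerIncreasing : ∀ c {xs} → Linked _<_ xs → All (c ≤_) xs →
  2 * length xs * c + length xs * length xs ≤ 2 * sum xs + length xs
sumLowerIncreasing c {[]}     _    _           = z≤n
sumLowerIncreasing c {x ∷ xs} incr (c≤x ∷ _) = begin
    2 * suc k * c + suc k * suc k     ≤⟨ +-monoˡ-≤ (suc k * suc k) (*-monoʳ-≤ (2 * suc k) c≤x) ⟩
    2 * suc k * x + suc k * suc k     ≡⟨ regroup k x ⟩
    (2 * k * suc x + k * k) + (2 * x + 1) ≤⟨ +-monoˡ-≤ (2 * x + 1) rest ⟩
    (2 * s + k) + (2 * x + 1)         ≡⟨ collect s k x ⟩
    2 * (x + s) + suc k               ∎
  where
    open ≤-Reasoning
    k = length xs
    s = sum xs
    rest : 2 * k * suc x + k * k ≤ 2 * s + k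
    rest = sumLowerIncreasing (suc x) (Linked.tail incr) (aboveHead incr)
    regroup : ∀ k x → 2 * suc k * x + suc k * suc k ≡ (2 * k * suc x + k * k) + (2 * x + 1)
    regroup = solve-∀
    collect : ∀ s k x → (2 * s + k) + (2 * x + 1) ≡ 2 * (x + s) + suc k
    collect = solve-∀

-- The head x of a strictly increasing list of length ℓ bounded by D has
-- x + ℓ ≤ D, since the ℓ - 1 later elements fit strictly between x and D.
headRoom : ∀ D {x xs} → Linked _<_ (x ∷ xs) → All (_< D) (x ∷ xs) → x + length (x ∷ xs) ≤ D
headRoom D {x} {[]}     _            (x<D ∷ []) = subst (_≤ D) (+-comm 1 x) x<D
headRoom D {x} {y ∷ ys} (x<y ∷ incr) (_ ∷ bounded) = begin
    x + suc (suc (length ys)) ≡⟨ +-suc x (suc (length ys)) ⟩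
    suc x + suc (length ys)   ≤⟨ +-monoˡ-≤ (suc (length ys)) x<y ⟩
    y + suc (length ys)       ≤⟨ headRoom D incr bounded ⟩
    D                         ∎
  where open ≤-Reasoning

sumUpperIncreasing : ∀ D {xs} → Linked _<_ xs → All (_< D) xs →
  2 * sum xs + length xs * length xs + length xs ≤ 2 * length xs * D
sumUpperIncreasing D {[]}     _    _                    = z≤n
sumUpperIncreasing D {x ∷ xs} incr bounded@(_ ∷ rest) = begin
    2 * (x + s) + suc k * suc k + suc k     ≡⟨ regroup x s k ⟩
    (2 * s + k * k + k) + 2 * (x + suc k) ≤⟨ +-mono-≤ tailBound (*-monoʳ-≤ 2 (headRoom D incr bounded)) ⟩
    2 * k * D + 2 * D                      ≡⟨ collect k D ⟩
    2 * suc k * D                          ∎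
  where
    open ≤-Reasoning
    k = length xs
    s = sum xs
    tailBound : 2 * s + k * k + k ≤ 2 * k * D
    tailBound = sumUpperIncreasing D (Linked.tail incr) rest
    regroup : ∀ x s k → 2 * (x + s) + suc k * suc k + suc k ≡ (2 * s + k * k + k) + 2 * (x + suc k)
    regroup = solve-∀
    collect : ∀ k D → 2 * k * D + 2 * D ≡ 2 * suc k * D
    collect = solve-∀

sumLower : ∀ c {xs} → Unique xs → All (c ≤_) xs →
  2 * length xs * c + length xs * length xs ≤ 2 * sum xs + length xs
sumLower c = fromIncreasing (c ≤_) (λ m s → 2 * m * c + m * m ≤ 2 * s + m) (sumLowerIncreasing c)

sumUpper : ∀ D {xs} → Unique xs → All (_< D) xs →
  2 * sum xs + length xs * length xs + length xs ≤ 2 * length xs * D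
sumUpper D = fromIncreasing (_< D) (λ m s → 2 * s + m * m + m ≤ 2 * m * D) (sumUpperIncreasing D)

smallSumBelow : ∀ {n} → 2 ≤ n → ∀ {ls ss} →
  Unique ls → All (_< 4 * n) ls → length ls ≡ n →
  Unique ss → All (n ≤_) ss → length ss ≡ n + n →
  sum ls < sum ss
smallSumBelow {n} 2≤n@(s≤s _) {ls} {ss} uls bls lenL uss bss lenS =
  *-cancelˡ-< 2 L S (+-cancelʳ-< (n + n) (2 * L) (2 * S) (begin-strict
    2 * L + (n + n)                      ≡⟨ +-assoc (2 * L) n n ⟨
    2 * L + n + n                        <⟨ +-monoˡ-< n (+-monoʳ-< (2 * L) (m<m*n n n 2≤n)) ⟩
    2 * L + n * n + n                    ≤⟨ upper ⟩
    2 * n * (4 * n)                      ≡⟨ bothEightSquares n ⟩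
    2 * (n + n) * n + (n + n) * (n + n)  ≤⟨ lower ⟩
    2 * S + (n + n)                      ∎))
  where
    open ≤-Reasoning
    L = sum ls
    S = sum ss
    upper : 2 * L + n * n + n ≤ 2 * n * (4 * n)
    upper = subst (λ m → 2 * L + m * m + m ≤ 2 * m * (4 * n)) lenL (sumUpper (4 * n) uls bls)
    lower : 2 * (n + n) * n + (n + n) * (n + n) ≤ 2 * S + (n + n)
    lower = subst (λ m → 2 * m * n + m * m ≤ 2 * S + m) lenS (sumLower n uss bss)
    bothEightSquares : ∀ n → 2 * n * (4 * n) ≡ 2 * (n + n) * n + (n + n) * (n + n)
    bothEightSquares = solve-∀

sumTabulate-+ : ∀ {n} (g h : Fin n → ℕ) →
  sum (tabulate (λ i → g i + h i)) ≡ sum (tabulate g) + sum (tabulate h)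
sumTabulate-+ {zero}  g h = refl
sumTabulate-+ {suc n} g h =
  trans (cong (g Fin.zero + h Fin.zero +_) (sumTabulate-+ (g ∘ Fin.suc) (h ∘ Fin.suc)))
        (interchange (g Fin.zero) (h Fin.zero) _ _)

sumTabulate-↑ : ∀ m {n} (v : Fin (m + n) → ℕ) →
  sum (tabulate v) ≡ sum (tabulate (λ i → v (i ↑ˡ n))) + sum (tabulate (λ j → v (m ↑ʳ j)))
sumTabulate-↑ zero    v = refl
sumTabulate-↑ (suc m) v =
  trans (cong (v Fin.zero +_) (sumTabulate-↑ m (v ∘ Fin.suc)))
        (sym (+-assoc (v Fin.zero) _ _))

-- The components of nK₂.  Element (i , r) of Fin n × Role is the left end,
-- right end or edge of the i-th copy of K₂; this identifies Fin n × Role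
-- with V ∪ E.
data Role : Set where
  left right edge : Role

component : ∀ {n} → Fin n → Role → Elem (nK₂ n)
component {n} i left  = inj₁ (i ↑ˡ n)
component {n} i right = inj₁ (n ↑ʳ i)
component     i edge  = inj₂ i

vertexRole : ∀ {n} → Fin n ⊎ Fin n → Fin n × Role
vertexRole = [ (λ i → i , left) , (λ i → i , right) ]′

locate : ∀ {n} → Elem (nK₂ n) → Fin n × Role
locate {n} (inj₁ v) = vertexRole (splitAt n v)
locate     (inj₂ i) = i , edge

locate-component : ∀ {n} (i : Fin n) r → locate (component i r) ≡ (i , r)
locate-component {n} i left  = cong vertexRole (splitAt-↑ˡ n i n)
locate-component {n} i right = cong vertexRole (splitAt-↑ʳ n n i)
locate-component     i edge  = refl

component-locate : ∀ {n} (x : Elem (nK₂ n)) → uncurry component (locate x) ≡ x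
component-locate {n} (inj₁ v) = trans (joined (splitAt n v)) (cong inj₁ (join-splitAt n n v))
  where
    joined : ∀ s → uncurry component (vertexRole s) ≡ inj₁ (join n n s)
    joined (inj₁ i) = refl
    joined (inj₂ i) = refl
component-locate (inj₂ i) = refl

permuteRoles : ∀ {n} → (Fin n → Role → Role) → Elem (nK₂ n) → Elem (nK₂ n)
permuteRoles σ x = uncurry (λ i r → component i (σ i r)) (locate x)

permuteRoles-component : ∀ {n} (σ : Fin n → Role → Role) i r →
  permuteRoles σ (component i r) ≡ component i (σ i r)
permuteRoles-component σ i r = cong (uncurry (λ i r → component i (σ i r))) (locate-component i r)

permuteRoles-involutive : ∀ {n} (σ : Fin n → Role → Role) →
  (∀ i r → σ i (σ i r) ≡ r) → ∀ x → permuteRoles σ (permuteRoles σ x) ≡ x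
permuteRoles-involutive σ σ-involutive x = begin
    π (π x)                    ≡⟨ cong (π ∘ π) (component-locate x) ⟨
    π (π (component i r))      ≡⟨ cong π (permuteRoles-component σ i r) ⟩
    π (component i (σ i r))    ≡⟨ permuteRoles-component σ i (σ i r) ⟩
    component i (σ i (σ i r))  ≡⟨ cong (component i) (σ-involutive i r) ⟩
    component i r              ≡⟨ component-locate x ⟩
    x                          ∎
  where
    open ≡-Reasoning
    π = permuteRoles σ
    i = proj₁ (locate x)
    r = proj₂ (locate x)

swapEdge : Role → Role → Role
swapEdge edge  s     = s
swapEdge left  left  = edge
swapEdge left  edge  = left
swapEdge left  right = right
swapEdge right right = edge
swapEdge right edge  = right
swapEdge right left  = left

swapEdge-involutive : ∀ r s → swapEdge r (swapEdge r s) ≡ s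
swapEdge-involutive edge  s     = refl
swapEdge-involutive left  left  = refl
swapEdge-involutive left  edge  = refl
swapEdge-involutive left  right = refl
swapEdge-involutive right right = refl
swapEdge-involutive right edge  = refl
swapEdge-involutive right left  = refl

bijOnto-∘-involution : ∀ G k {f : Elem G → ℕ} (π : Elem G → Elem G) →
  (∀ x → π (π x) ≡ x) → IsBijOnto G k f → IsBijOnto G k (f ∘ π)
bijOnto-∘-involution G k {f} π π-involutive (inRange , injective , onto) =
  (λ x → inRange (π x)) ,
  (λ {x} {y} fπx≡fπy → begin
      x         ≡⟨ π-involutive x ⟨
      π (π x)   ≡⟨ cong π (injective fπx≡fπy) ⟩
      π (π y)   ≡⟨ π-involutive y ⟩
      y         ∎) ,
  (λ m m∈range → let (x , fx≡m) = onto m m∈range in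
     π x , trans (cong f (π-involutive x)) fx≡m)
  where open ≡-Reasoning

ComponentCondition : Set₁
ComponentCondition = ℕ → ℕ → ℕ → Set

Holds : ComponentCondition → (Role → ℕ) → Set
Holds C ℓ = C (ℓ left) (ℓ right) (ℓ edge)

Holds-resp-≗ : ∀ (C : ComponentCondition) {ℓ ℓ′ : Role → ℕ} →
  (∀ r → ℓ r ≡ ℓ′ r) → Holds C ℓ → Holds C ℓ′
Holds-resp-≗ C ℓ≗ℓ′ holds =
  subst₂ (λ a b → C a b _) (ℓ≗ℓ′ left) (ℓ≗ℓ′ right) (subst (C _ _) (ℓ≗ℓ′ edge) holds)

Graceful Additive : ComponentCondition
Graceful a b e = e ≡ ∣ a - b ∣
Additive a b e = e ≡ a + b

reassignRoles : ∀ {n k} (P Q : ComponentCondition) →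
  (∀ ℓ → Holds P ℓ → Σ Role λ r → Holds Q (ℓ ∘ swapEdge r)) →
  (f : Elem (nK₂ n) → ℕ) → IsBijOnto (nK₂ n) k f → (∀ i → Holds P (f ∘ component i)) →
  Σ (Elem (nK₂ n) → ℕ) λ g → IsBijOnto (nK₂ n) k g × (∀ i → Holds Q (g ∘ component i))
reassignRoles {n} {k} P Q exchange f bij holdsP =
  f ∘ π ,
  bijOnto-∘-involution (nK₂ n) k π (permuteRoles-involutive σ (swapEdge-involutive ∘ choice)) bij ,
  λ i → Holds-resp-≗ Q (λ r → sym (cong f (permuteRoles-component σ i r)))
                       (proj₂ (exchange (f ∘ component i) (holdsP i)))
  where
    choice : Fin n → Role
    choice i = proj₁ (exchange (f ∘ component i) (holdsP i))
    σ : Fin n → Role → Role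
    σ i = swapEdge (choice i)
    π = permuteRoles σ

-- One component: e = ∣ a - b ∣ gives max(a,b) = min(a,b) + e, and
-- e = a + b gives a = ∣ e - b ∣.
graceful⇒additive : ∀ ℓ → Holds Graceful ℓ → Σ Role λ r → Holds Additive (ℓ ∘ swapEdge r)
graceful⇒additive ℓ e≡∣a-b∣ with ≤-total (ℓ left) (ℓ right)
... | inj₁ a≤b = right , (begin
      ℓ right                          ≡⟨ m+[n∸m]≡n a≤b ⟨
      ℓ left + (ℓ right ∸ ℓ left)      ≡⟨ cong (ℓ left +_) (trans (sym (m≤n⇒∣m-n∣≡n∸m a≤b)) (sym e≡∣a-b∣)) ⟩
      ℓ left + ℓ edge                  ∎)
  where open ≡-Reasoning
... | inj₂ b≤a = left , (begin
      ℓ left                           ≡⟨ m∸n+n≡m b≤a ⟨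
      (ℓ left ∸ ℓ right) + ℓ right     ≡⟨ cong (_+ ℓ right) (trans (sym (m≤n⇒∣n-m∣≡n∸m b≤a)) (sym e≡∣a-b∣)) ⟩
      ℓ edge + ℓ right                 ∎)
  where open ≡-Reasoning

additive⇒graceful : ∀ ℓ → Holds Additive ℓ → Σ Role λ r → Holds Graceful (ℓ ∘ swapEdge r)
additive⇒graceful ℓ e≡a+b = left , (begin
    ℓ left                              ≡⟨ m+n∸n≡m (ℓ left) (ℓ right) ⟨
    ℓ left + ℓ right ∸ ℓ right          ≡⟨ m≤n⇒∣n-m∣≡n∸m (m≤n+m (ℓ right) (ℓ left)) ⟨
    ∣ ℓ left + ℓ right - ℓ right ∣      ≡⟨ cong (λ e → ∣ e - ℓ right ∣) e≡a+b ⟨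
    ∣ ℓ edge - ℓ right ∣                ∎)
  where open ≡-Reasoning

superGraceful⇔seqAdditive : ∀ n k → KSuperGraceful (nK₂ n) k ⇔ KSeqAdditive (nK₂ n) k
superGraceful⇔seqAdditive n k =
  mk⇔ (λ (f , bij , graceful) → reassignRoles Graceful Additive graceful⇒additive f bij graceful)
      (λ (f , bij , additive) → reassignRoles Additive Graceful additive⇒graceful f bij additive)

-- No n-sequentially additive labelling of nK₂ exists for n ≥ 2: the edge
-- labels are n distinct numbers below 4n, the vertex labels 2n distinct
-- numbers ≥ n, yet both lists have the same sum.
noSeqAdditive : ∀ {n} → 2 ≤ n → ¬ KSeqAdditive (nK₂ n) n
noSeqAdditive {n@(suc _)} 2≤n (f , (inRange , injective , _) , additive) =
  <-irrefl edgeSum≡vertexSum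
    (smallSumBelow 2≤n
      (Unique.tabulate⁺ (inj₂-injective ∘ injective)) edgesBelow (length-tabulate (f ∘ inj₂))
      (Unique.tabulate⁺ (inj₁-injective ∘ injective)) verticesAbove (length-tabulate (f ∘ inj₁)))
  where
    open ≡-Reasoning
    a b : Fin n → ℕ
    a i = f (component i left)
    b i = f (component i right)
    edgeSum≡vertexSum : sum (tabulate (f ∘ inj₂)) ≡ sum (tabulate (f ∘ inj₁))
    edgeSum≡vertexSum = begin
      sum (tabulate (f ∘ inj₂))                 ≡⟨ cong sum (tabulate-cong additive) ⟩
      sum (tabulate (λ i → a i + b i))          ≡⟨ sumTabulate-+ a b ⟩
      sum (tabulate a) + sum (tabulate b)       ≡⟨ sumTabulate-↑ n (f ∘ inj₁) ⟨
      sum (tabulate (f ∘ inj₁))                 ∎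
    top≡4n : ∀ m → m + ((m + m) + m) ≡ 4 * m
    top≡4n = solve-∀
    edgesBelow : All (_< 4 * n) (tabulate (f ∘ inj₂))
    edgesBelow = All.tabulate⁺ λ i → subst (f (inj₂ i) <_) (top≡4n n) (s≤s (proj₂ (inRange (inj₂ i))))
    verticesAbove : All (n ≤_) (tabulate (f ∘ inj₁))
    verticesAbove = All.tabulate⁺ λ v → proj₁ (inRange (inj₁ v))

bijOnto-fromInverse : ∀ G k (f : Elem G → ℕ) (g : ℕ → Elem G) →
  (∀ x → InRange k (p G + q G) (f x)) → (∀ x → g (f x) ≡ x) →
  (∀ m → InRange k (p G + q G) m → f (g m) ≡ m) → IsBijOnto G k f
bijOnto-fromInverse G k f g inRange g∘f f∘g =
  inRange ,
  (λ {x} {y} fx≡fy → trans (sym (g∘f x)) (trans (cong g fx≡fy) (g∘f y))) ,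
  (λ m m∈range → g m , f∘g m m∈range)

K₂-seqAdditive : KSeqAdditive (nK₂ 1) 1
K₂-seqAdditive = label , bijOnto-fromInverse (nK₂ 1) 1 label element inRange element∘label label∘element
                       , λ { Fin.zero → refl }
  where
    label : Elem (nK₂ 1) → ℕ
    label (inj₁ Fin.zero)            = 1
    label (inj₁ (Fin.suc Fin.zero)) = 2
    label (inj₂ Fin.zero)            = 3
    element : ℕ → Elem (nK₂ 1)
    element 1 = component Fin.zero left
    element 2 = component Fin.zero right
    element _ = component Fin.zero edge
    inRange : ∀ x → InRange 1 3 (label x)
    inRange (inj₁ Fin.zero)            = s≤s z≤n , s≤s z≤n
    inRange (inj₁ (Fin.suc Fin.zero)) = s≤s z≤n , s≤s (s≤s z≤n)
    inRange (inj₂ Fin.zero)            = s≤s z≤n , s≤s (s≤s (s≤s z≤n))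
    element∘label : ∀ x → element (label x) ≡ x
    element∘label (inj₁ Fin.zero)            = refl
    element∘label (inj₁ (Fin.suc Fin.zero)) = refl
    element∘label (inj₂ Fin.zero)            = refl
    label∘element : ∀ m → InRange 1 3 m → label (element m) ≡ m
    label∘element 0                     (() , _)
    label∘element 1                     _ = refl
    label∘element 2                     _ = refl
    label∘element 3                     _ = refl
    label∘element (suc (suc (suc (suc _)))) (_ , s≤s (s≤s (s≤s ())))

seqAdditive⇔one : ∀ n → 1 ≤ n → KSeqAdditive (nK₂ n) n ⇔ n ≡ 1
seqAdditive⇔one n 1≤n = mk⇔ onlyOne (λ { refl → K₂-seqAdditive })
  where
    onlyOne : KSeqAdditive (nK₂ n) n → n ≡ 1
    onlyOne labelling with m≤n⇒m<n∨m≡n 1≤n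
    ... | inj₁ 2≤n = ⊥-elim (noSeqAdditive 2≤n labelling)
    ... | inj₂ 1≡n = sym 1≡n

theorem3p6 : (n : ℕ) → 1 ≤ n →
    (KSuperGraceful (nK₂ n) n ⇔ n ≡ 1) × (KSeqAdditive (nK₂ n) n ⇔ n ≡ 1)
theorem3p6 n 1≤n =
  seqAdditive⇔one n 1≤n ⇔-∘ superGraceful⇔seqAdditive n n ,
  seqAdditive⇔one n 1≤n
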